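{- Let $\ell$ be a positive integer and for $1\le r\le\lfloor\ell/2\rfloor$ define recursively (in $r$, for integers $m$) \[ A_{1,\ell}(m)=1,\qquad A_{r,\ell}(m)=A_{r-1,\ell}(m)-\binom{\ell-2(r-1)}{m-(r-1)}A_{r-1,\ell}(r-1); \] \[ B_{1,\ell}(m)=\binom{\ell}{m}-1,\qquad B_{r,\ell}(m)=B_{r-1,\ell}(m)-\binom{\ell-2(r-1)}{m-(r-1)}B_{r-1,\ell}(r-1), \] and put $\alpha_{r,\ell}=A_{r,\ell}(r)$, $\beta_{r,\ell}=B_{r,\ell}(r)$. Then for $2\le r\le\lfloor\ell/2\rfloor-1$, \[ \alpha_{r-1,\ell-2}+\alpha_{r,\ell}-\alpha_{r,\ell-1}=0,\qquad \beta_{r-1,\ell-2}+\beta_{r,\ell}-\beta_{r,\ell-1}=0. \] -}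

module Defs where

open import Data.Nat as ℕ using (ℕ; zero; suc)
open import Data.Nat.Combinatorics using (_C_)
open import Data.Integer using (ℤ; +_; -[1+_]; _+_; _-_; _*_; 0ℤ; 1ℤ)

-- Binomial coefficient with natural upper index n and integer lower index k:
-- (n choose k) = 0 for k < 0 (and n C k = 0 for k > n, as in the stdlib).
binomℤ : ℕ → ℤ → ℤ
binomℤ n (+ k)    = + (n C k)
binomℤ n -[1+ _ ] = 0ℤ

-- A ℓ r m  =  A_{r,ℓ}(m), for r ≥ 1.  (r = 0 is an unused junk value.)
A : ℕ → ℕ → ℤ → ℤ
A ℓ zero m = 1ℤ
A ℓ (suc zero) m = 1ℤ
A ℓ (suc (suc k)) m =
  A ℓ (suc k) m - binomℤ (ℓ ℕ.∸ 2 ℕ.* suc k) (m - + suc k) * A ℓ (suc k) (+ suc k)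

-- B ℓ r m  =  B_{r,ℓ}(m), for r ≥ 1.  (r = 0 is an unused junk value.)
B : ℕ → ℕ → ℤ → ℤ
B ℓ zero m = 0ℤ
B ℓ (suc zero) m = binomℤ ℓ m - 1ℤ
B ℓ (suc (suc k)) m =
  B ℓ (suc k) m - binomℤ (ℓ ℕ.∸ 2 ℕ.* suc k) (m - + suc k) * B ℓ (suc k) (+ suc k)

α : ℕ → ℕ → ℤ
α r ℓ = A ℓ r (+ r)

β : ℕ → ℕ → ℤ
β r ℓ = B ℓ r (+ r)

module Submission where

-- Both families obey the same recursion in the rank r:
--   X_{r+1,ℓ}(m) = X_{r,ℓ}(m) − c_{r,ℓ}(m) · X_{r,ℓ}(r),   c_{r,ℓ}(m) = (ℓ−2r choose m−r),
-- and they differ only at rank 1.  The proof rests on a three-term relation in ℓ,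
--   X_{r,ℓ+2}(m) = X_{r,ℓ+1}(m) + X_{r,ℓ+1}(m−1) − X_{r−1,ℓ}(m−1)      (2 ≤ r, 2r ≤ ℓ),
-- established by induction on r for any family obeying the recursion (module
-- 'Recursion').  The inductive step needs only Pascal's rule for the coefficients,
--   c_{r,ℓ+2}(m) = c_{r,ℓ+1}(m) + c_{r,ℓ+1}(m−1) = c_{r−1,ℓ}(m−1),
-- and the base case r = 2 is a direct computation from the rank-1 values of A and B.
-- Evaluating the relation at m = r and using X_{r,ℓ}(r−1) = 0 (the coefficient
-- there is (… choose 0) = 1) gives α_{r,ℓ+2} = α_{r,ℓ+1} − α_{r−1,ℓ}, and likewise
-- for β.  The hypothesis r ≤ ⌊ℓ/2⌋ − 1 of the corollary only serves to provide
-- ℓ ≥ 2r + 2, i.e. the size condition of the three-term relation for ℓ − 2.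

open import Defs
open import Data.Nat as ℕ using (ℕ; zero; suc; _≤_; _∸_; s≤s; z≤n)
open import Data.Nat.Combinatorics using (_C_; nCk+nC[k+1]≡[n+1]C[k+1])
open import Data.Nat.DivMod using (_/_; m/n*n≤m)
import Data.Nat.Properties as ℕP
open import Data.Nat.Tactic.RingSolver as ℕSolver using ()
open import Data.Integer using (ℤ; +_; -[1+_]; _+_; _-_; _*_; 0ℤ; 1ℤ)
import Data.Integer.Properties as ℤP
open import Data.Integer.Tactic.RingSolver using (solve-∀)
open import Data.Product using (_×_; _,_)
open import Relation.Binary.PropositionalEquality
open ≡-Reasoning

pascal : ∀ N k → binomℤ (suc N) k ≡ binomℤ N k + binomℤ N (k - 1ℤ)
pascal N (+ zero)  = refl
pascal N (+ suc j) =
  cong +_ (trans (sym (nCk+nC[k+1]≡[n+1]C[k+1] N j)) (ℕP.+-comm (N C j) (N C suc j)))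
pascal N -[1+ j ]  = refl

-- The coefficient c_{k+1,ℓ}(m) = (ℓ − 2(k+1) choose m − (k+1)) used in passing
-- from rank k+1 to rank k+2; A and B unfold to exactly this expression.
coef : ℕ → ℕ → ℤ → ℤ
coef ℓ k m = binomℤ (ℓ ∸ 2 ℕ.* suc k) (m - + suc k)

coef-pascal : ∀ n k m → 2 ℕ.* suc k ≤ suc n →
  coef (suc (suc n)) k m ≡ coef (suc n) k m + coef (suc n) k (m - 1ℤ)
coef-pascal n k m le = begin
  binomℤ (suc (suc n) ∸ 2 ℕ.* suc k) (m - + suc k)
    ≡⟨ cong (λ N → binomℤ N (m - + suc k)) (ℕP.+-∸-assoc 1 le) ⟩
  binomℤ (suc (suc n ∸ 2 ℕ.* suc k)) (m - + suc k)
    ≡⟨ pascal (suc n ∸ 2 ℕ.* suc k) (m - + suc k) ⟩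
  coef (suc n) k m + binomℤ (suc n ∸ 2 ℕ.* suc k) ((m - + suc k) - 1ℤ)
    ≡⟨ cong (λ j → coef (suc n) k m + binomℤ (suc n ∸ 2 ℕ.* suc k) j) (swap m (+ suc k)) ⟩
  coef (suc n) k m + coef (suc n) k (m - 1ℤ) ∎
  where
  swap : ∀ m j → (m - j) - 1ℤ ≡ (m - 1ℤ) - j
  swap = solve-∀

coef-shift : ∀ n k m → coef n k (m - 1ℤ) ≡ coef (suc (suc n)) (suc k) m
coef-shift n k m =
  cong₂ binomℤ (sym (cong (suc (suc n) ∸_) (ℕP.*-suc 2 (suc k)))) (ℤP.+-assoc m -[1+ 0 ] -[1+ k ])

lower-rank : ∀ {n} r → 2 ℕ.* suc r ≤ n → 2 ℕ.* r ≤ n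
lower-rank r = ℕP.≤-trans (ℕP.*-monoʳ-≤ 2 (ℕP.n≤1+n r))

module Recursion (X : ℕ → ℕ → ℤ → ℤ)
  (recursion : ∀ ℓ k m →
    X ℓ (suc (suc k)) m ≡ X ℓ (suc k) m - coef ℓ k m * X ℓ (suc k) (+ suc k)) where

  -- X_{r,ℓ}(r−1) = 0 for r ≥ 2, since the coefficient c_{r−1,ℓ}(r−1) is (… choose 0) = 1.
  vanishes : ∀ ℓ k → X ℓ (suc (suc k)) (+ suc k) ≡ 0ℤ
  vanishes ℓ k = begin
    X ℓ (suc (suc k)) (+ suc k)
      ≡⟨ recursion ℓ k (+ suc k) ⟩
    x - binomℤ (ℓ ∸ 2 ℕ.* suc k) (+ suc k - + suc k) * x
      ≡⟨ cong (λ j → x - binomℤ (ℓ ∸ 2 ℕ.* suc k) j * x) (ℤP.+-inverseʳ (+ suc k)) ⟩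
    x - 1ℤ * x
      ≡⟨ cong (x -_) (ℤP.*-identityˡ x) ⟩
    x - x
      ≡⟨ ℤP.+-inverseʳ x ⟩
    0ℤ ∎
    where x = X ℓ (suc k) (+ suc k)

  ThreeTerm : ℕ → ℕ → Set
  ThreeTerm n j = ∀ m →
    X (suc (suc n)) (suc j) m ≡ X (suc n) (suc j) m + X (suc n) (suc j) (m - 1ℤ) - X n j (m - 1ℤ)

  -- The relation propagates from rank k+2 to rank k+3: each of the three terms obeys
  -- the recursion, and the three coefficients are tied together by Pascal's rule.
  three-term-step : ∀ n k → 2 ℕ.* suc (suc k) ≤ suc n →
    ThreeTerm n (suc k) → ThreeTerm n (suc (suc k))
  three-term-step n k le ih m = begin
    X (suc (suc n)) (suc (suc (suc k))) m
      ≡⟨ recursion (suc (suc n)) (suc k) m ⟩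
    X (suc (suc n)) (suc (suc k)) m - coef (suc (suc n)) (suc k) m * X (suc (suc n)) (suc (suc k)) (+ suc (suc k))
      ≡⟨ cong₂ (λ y c → y - c * X (suc (suc n)) (suc (suc k)) (+ suc (suc k))) (ih m) c≡c₁+c₂ ⟩
    (y₁ + y₂ - y₀) - (c₁ + c₂) * X (suc (suc n)) (suc (suc k)) (+ suc (suc k))
      ≡⟨ cong (λ x → (y₁ + y₂ - y₀) - (c₁ + c₂) * x) pivot ⟩
    (y₁ + y₂ - y₀) - (c₁ + c₂) * (x₁ - x₀)
      ≡⟨ distribute y₁ y₂ y₀ x₁ x₀ c₁ c₂ ⟩
    (y₁ - c₁ * x₁) + (y₂ - c₂ * x₁) - (y₀ - (c₁ + c₂) * x₀)
      ≡⟨ cong (λ c → (y₁ - c₁ * x₁) + (y₂ - c₂ * x₁) - (y₀ - c * x₀))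
           (sym (trans (coef-shift n k m) c≡c₁+c₂)) ⟩
    (y₁ - c₁ * x₁) + (y₂ - c₂ * x₁) - (y₀ - coef n k (m - 1ℤ) * x₀)
      ≡⟨ sym (cong₂ _-_ (cong₂ _+_ (recursion (suc n) (suc k) m) (recursion (suc n) (suc k) (m - 1ℤ)))
                         (recursion n k (m - 1ℤ))) ⟩
    X (suc n) (suc (suc (suc k))) m + X (suc n) (suc (suc (suc k))) (m - 1ℤ) - X n (suc (suc k)) (m - 1ℤ) ∎
    where
    y₁ = X (suc n) (suc (suc k)) m
    y₂ = X (suc n) (suc (suc k)) (m - 1ℤ)
    y₀ = X n (suc k) (m - 1ℤ)
    x₁ = X (suc n) (suc (suc k)) (+ suc (suc k))
    x₀ = X n (suc k) (+ suc k)
    c₁ = coef (suc n) (suc k) m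
    c₂ = coef (suc n) (suc k) (m - 1ℤ)

    c≡c₁+c₂ : coef (suc (suc n)) (suc k) m ≡ c₁ + c₂
    c≡c₁+c₂ = coef-pascal n (suc k) m le

    pivot : X (suc (suc n)) (suc (suc k)) (+ suc (suc k)) ≡ x₁ - x₀
    pivot = begin
      X (suc (suc n)) (suc (suc k)) (+ suc (suc k))
        ≡⟨ ih (+ suc (suc k)) ⟩
      x₁ + X (suc n) (suc (suc k)) (+ suc k) - x₀
        ≡⟨ cong (λ z → x₁ + z - x₀) (vanishes (suc n) k) ⟩
      x₁ + 0ℤ - x₀
        ≡⟨ cong (_- x₀) (ℤP.+-identityʳ x₁) ⟩
      x₁ - x₀ ∎

    distribute : ∀ y₁ y₂ y₀ x₁ x₀ c₁ c₂ →
      (y₁ + y₂ - y₀) - (c₁ + c₂) * (x₁ - x₀)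
        ≡ (y₁ - c₁ * x₁) + (y₂ - c₂ * x₁) - (y₀ - (c₁ + c₂) * x₀)
    distribute = solve-∀

  three-term : (∀ n → ThreeTerm (suc n) 1) → ∀ n k → 2 ℕ.* suc k ≤ n → ThreeTerm n (suc k)
  three-term base (suc n) zero    _  = base n
  three-term base n       (suc k) le =
    three-term-step n k (ℕP.m≤n⇒m≤1+n le) (three-term base n k (lower-rank (suc k) le))

  diagonal : ∀ n k → ThreeTerm n (suc k) →
    X n (suc k) (+ suc k) + X (suc (suc n)) (suc (suc k)) (+ suc (suc k))
      - X (suc n) (suc (suc k)) (+ suc (suc k)) ≡ 0ℤ
  diagonal n k rel = begin
    x₀ + X (suc (suc n)) (suc (suc k)) (+ suc (suc k)) - x₁
      ≡⟨ cong (λ z → x₀ + z - x₁) (rel (+ suc (suc k))) ⟩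
    x₀ + (x₁ + X (suc n) (suc (suc k)) (+ suc k) - x₀) - x₁
      ≡⟨ cong (λ z → x₀ + (x₁ + z - x₀) - x₁) (vanishes (suc n) k) ⟩
    x₀ + (x₁ + 0ℤ - x₀) - x₁
      ≡⟨ cancel x₀ x₁ ⟩
    0ℤ ∎
    where
    x₀ = X n (suc k) (+ suc k)
    x₁ = X (suc n) (suc (suc k)) (+ suc (suc k))
    cancel : ∀ a b → a + (b + 0ℤ - a) - b ≡ 0ℤ
    cancel = solve-∀

module RecA = Recursion A (λ ℓ k m → refl)
module RecB = Recursion B (λ ℓ k m → refl)

A-rank2 : ∀ n → RecA.ThreeTerm (suc n) 1
A-rank2 n m = begin
  1ℤ - coef (suc (suc (suc n))) 0 m * 1ℤ
    ≡⟨ cong (λ c → 1ℤ - c * 1ℤ) (coef-pascal (suc n) 0 m (s≤s (s≤s z≤n))) ⟩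
  1ℤ - (c₁ + c₂) * 1ℤ
    ≡⟨ split c₁ c₂ ⟩
  (1ℤ - c₁ * 1ℤ) + (1ℤ - c₂ * 1ℤ) - 1ℤ ∎
  where
  c₁ = coef (suc (suc n)) 0 m
  c₂ = coef (suc (suc n)) 0 (m - 1ℤ)
  split : ∀ a b → 1ℤ - (a + b) * 1ℤ ≡ (1ℤ - a * 1ℤ) + (1ℤ - b * 1ℤ) - 1ℤ
  split = solve-∀

-- Rank 2 for B: Pascal's rule splits (ℓ choose m), (ℓ choose 1) and the coefficient.
-- Note that B_{1,n+1}(m−1) = c − 1 for the coefficient c = c_{1,n+3}(m).
B-rank2 : ∀ n → RecB.ThreeTerm (suc n) 1
B-rank2 n m = begin
  (binomℤ L m - 1ℤ) - c * (binomℤ L (+ 1) - 1ℤ)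
    ≡⟨ cong₂ (λ p q → (p - 1ℤ) - c * (q - 1ℤ)) (pascal N m) (pascal N (+ 1)) ⟩
  (p₁ + p₂ - 1ℤ) - c * (u + 1ℤ - 1ℤ)
    ≡⟨ cong (λ d → (p₁ + p₂ - 1ℤ) - d * (u + 1ℤ - 1ℤ)) c≡c₁+c₂ ⟩
  (p₁ + p₂ - 1ℤ) - (c₁ + c₂) * (u + 1ℤ - 1ℤ)
    ≡⟨ split p₁ p₂ u c₁ c₂ ⟩
  (p₁ - 1ℤ - c₁ * (u - 1ℤ)) + (p₂ - 1ℤ - c₂ * (u - 1ℤ)) - (c₁ + c₂ - 1ℤ)
    ≡⟨ cong (λ d → (p₁ - 1ℤ - c₁ * (u - 1ℤ)) + (p₂ - 1ℤ - c₂ * (u - 1ℤ)) - (d - 1ℤ)) (sym c≡c₁+c₂) ⟩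
  (p₁ - 1ℤ - c₁ * (u - 1ℤ)) + (p₂ - 1ℤ - c₂ * (u - 1ℤ)) - (c - 1ℤ) ∎
  where
  N  = suc (suc n)
  L  = suc N
  c  = coef L 0 m
  c₁ = coef N 0 m
  c₂ = coef N 0 (m - 1ℤ)
  p₁ = binomℤ N m
  p₂ = binomℤ N (m - 1ℤ)
  u  = binomℤ N (+ 1)
  c≡c₁+c₂ : c ≡ c₁ + c₂
  c≡c₁+c₂ = coef-pascal (suc n) 0 m (s≤s (s≤s z≤n))
  split : ∀ p₁ p₂ u c₁ c₂ →
    (p₁ + p₂ - 1ℤ) - (c₁ + c₂) * (u + 1ℤ - 1ℤ)
      ≡ (p₁ - 1ℤ - c₁ * (u - 1ℤ)) + (p₂ - 1ℤ - c₂ * (u - 1ℤ)) - (c₁ + c₂ - 1ℤ)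
  split = solve-∀

length-bound : ∀ ℓ r → 1 ≤ r → r ≤ ℓ / 2 ∸ 1 → 2 ℕ.+ 2 ℕ.* r ≤ ℓ
length-bound ℓ r 1≤r r≤ =
  subst (_≤ ℓ) (sym (twice r))
    (ℕP.≤-trans (ℕP.*-monoˡ-≤ 2 (ℕP.m≤o∸n⇒m+n≤o r 1≤half r≤)) (m/n*n≤m ℓ 2))
  where
  1≤half : 1 ≤ ℓ / 2
  1≤half = ℕP.≤-trans 1≤r (ℕP.≤-trans r≤ (ℕP.m∸n≤m (ℓ / 2) 1))
  twice : ∀ r → 2 ℕ.+ 2 ℕ.* r ≡ (r ℕ.+ 1) ℕ.* 2
  twice = ℕSolver.solve-∀

corollary4p5 : (ℓ r : ℕ) → 1 ≤ ℓ → 2 ≤ r → r ≤ ℓ / 2 ∸ 1 →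
    (α (r ∸ 1) (ℓ ∸ 2) + α r ℓ - α r (ℓ ∸ 1) ≡ 0ℤ)
    × (β (r ∸ 1) (ℓ ∸ 2) + β r ℓ - β r (ℓ ∸ 1) ≡ 0ℤ)
corollary4p5 ℓ r@(suc (suc k)) _ (s≤s (s≤s _)) r≤ with length-bound ℓ r (s≤s z≤n) r≤
... | s≤s (s≤s {n = n} 2r≤n) =
  RecA.diagonal n k (RecA.three-term A-rank2 n k (lower-rank (suc k) 2r≤n)) ,
  RecB.diagonal n k (RecB.three-term B-rank2 n k (lower-rank (suc k) 2r≤n))
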